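{- For all $\psi,\chi\in\mathcal{L}$ and all pairwise distinct individual variables $x,y,z,w$: (1) $Th\models_{fo}\forall x\big(ST_x(\psi\mathbin{\Box\!\!\to}\chi)\to\forall y\big((Sy\wedge(\forall z)_O(Ezy\leftrightarrow ST_z(\psi)))\to\forall w(Rxyw\to ST_w(\chi))\big)\big)$; (2) $Th\models_{fo}\forall x\big(ST_x(\psi\mathbin{\Diamond\!\!\to}\chi)\to\forall y\big((Sy\wedge(\forall z)_O(Ezy\leftrightarrow ST_z(\psi)))\to\exists w(Rxyw\wedge ST_w(\chi))\big)\big)$.
   Context: $\mathcal{L}$ is built from a countably infinite set $Var$ of propositional variables and $\top,\bot$ by $\wedge,\vee,\to$ and conditional connectives $\phi\mathbin{\Box\!\!\to}\psi$, $\phi\mathbin{\Diamond\!\!\to}\psi$. $\mathcal{L}_{fo}$ has individual variables, atoms $px$ ($p\in Var$), $Rxyz$, $Ox$, $Sx$, $Exy$, $x\equiv y$, $\top,\bot$, connectives $\wedge,\vee,\to$, quantifiers; $\neg\phi:=\phi\to\bot$; $(\forall x)_O\phi:=\forall x(Ox\to\phi)$. $\models_{fo}$ is intuitionistic first-order consequence via Kripke sheaves: a preorder of worlds, classical structures at each world for this signature, and homomorphisms $\mathbb{H}_{wv}$ for $w\leq v$ (identity for $w\leq w$, composing along chains), with the usual intuitionistic forcing clauses ($\to$ and $\forall$ quantify over all later worlds, transporting the assignment along $\mathbb{H}$; $\equiv$ is identity); $\Sigma\models_{fo}\Pi$ iff no world and assignment force all of $\Sigma$ and none of $\Pi$. $Th$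 consists of: $\forall x(Sx\vee Ox)$; $\forall x\neg(Sx\wedge Ox)$; $\forall x(px\to Ox)$ for $p\in Var$; $\forall x\forall y(Exy\to(Ox\wedge Sy))$; $\forall x\forall y\forall z(Rxyz\to(Ox\wedge Sy\wedge Oz))$; $\exists x(Sx\wedge\forall y(Eyx\leftrightarrow py))$ for $p\in Var$; $\exists x(Sx\wedge(\forall y)_O Eyx)$; $\exists x(Sx\wedge\forall y\neg Eyx)$; $\forall x\forall y((Sx\wedge Sy)\to\exists z(Sz\wedge(\forall w)_O(Ewz\leftrightarrow(Ewx\ast Ewy))))$ for $\ast\in\{\wedge,\vee,\to\}$; $\forall x\forall y((Sx\wedge Sy)\to\exists z(Sz\wedge(\forall w)_O(Ewz\leftrightarrow\forall u(Rwxu\to Euy))))$; $\forall x\forall y((Sx\wedge Sy)\to\exists z(Sz\wedge(\forall w)_O(Ewz\leftrightarrow\exists u(Rwxu\wedge Euy))))$; $\forall x\forall y((Sx\wedge Sy\wedge(\forall z)_O(Ezx\leftrightarrow Ezy))\to x\equiv y)$. Standard translation (with $x,y,z,w$ pairwise distinct): $ST_x(p)=px$; $ST_x(\top)=\top$, $ST_x(\bot)=\bot$; $ST_x(\psi\ast\chi)=ST_x(\psi)\ast ST_x(\chi)$ for $\ast\in\{\wedge,\vee,\to\}$; $ST_x(\psi\mathbin{\Box\!\!\to}\chi)=\exists y(Sy\wedge(\forall z)_O(Ezy\leftrightarrow ST_z(\psi))\wedge\forall w(Rxyw\to ST_w(\chi)))$; $ST_x(\psi\mathbin{\Diamond\!\!\to}\chi)=\exists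 y(Sy\wedge(\forall z)_O(Ezy\leftrightarrow ST_z(\psi))\wedge\exists w(Rxyw\wedge ST_w(\chi)))$. -}

module Defs where

open import Data.Nat using (ℕ; zero; suc; _≡ᵇ_)
open import Data.Bool using (if_then_else_)
open import Data.Product using (Σ; _×_; _,_)
open import Data.Sum using (_⊎_)
open import Data.Unit using (⊤)
open import Data.Empty using (⊥)
open import Relation.Binary.PropositionalEquality using (_≡_)

data 𝓛 : Set where
  var      : ℕ → 𝓛
  ⊤ᶜ ⊥ᶜ    : 𝓛
  _∧ᶜ_ _∨ᶜ_ _→ᶜ_ : 𝓛 → 𝓛 → 𝓛
  _□→_ _◇→_ : 𝓛 → 𝓛 → 𝓛

data Fm : Set where
  P    : ℕ → ℕ → Fm          -- P p x  is  "p x"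
  R    : ℕ → ℕ → ℕ → Fm
  O S  : ℕ → Fm
  E    : ℕ → ℕ → Fm
  _≐_  : ℕ → ℕ → Fm
  ⊤ᶠ ⊥ᶠ : Fm
  _∧ᶠ_ _∨ᶠ_ _⇒_ : Fm → Fm → Fm
  ∀ᶠ ∃ᶠ : ℕ → Fm → Fm

infixr 6 _∧ᶠ_
infixr 5 _∨ᶠ_
infixr 4 _⇒_ _⇔_

¬ᶠ : Fm → Fm
¬ᶠ φ = φ ⇒ ⊥ᶠ

_⇔_ : Fm → Fm → Fm
φ ⇔ ψ = (φ ⇒ ψ) ∧ᶠ (ψ ⇒ φ)

∀O : ℕ → Fm → Fm
∀O x φ = ∀ᶠ x (O x ⇒ φ)

record KripkeSheaf : Set₁ where
  field
    W     : Set
    _≤_   : W → W → Set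
    ≤-refl  : ∀ {w} → w ≤ w
    ≤-trans : ∀ {u v w} → u ≤ v → v ≤ w → u ≤ w
    D     : W → Set
    Pᴵ    : ∀ w → ℕ → D w → Set
    Rᴵ    : ∀ w → D w → D w → D w → Set
    Oᴵ Sᴵ : ∀ w → D w → Set
    Eᴵ    : ∀ w → D w → D w → Set
    H     : ∀ {w v} → w ≤ v → D w → D v
    H-irrel : ∀ {w v} (p q : w ≤ v) (d : D w) → H p d ≡ H q d
    H-refl  : ∀ {w} (d : D w) → H (≤-refl {w}) d ≡ d
    H-trans : ∀ {u v w} (p : u ≤ v) (q : v ≤ w) (d : D u) →
              H (≤-trans p q) d ≡ H q (H p d)
    H-P : ∀ {w v} (le : w ≤ v) p d → Pᴵ w p d → Pᴵ v p (H le d)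
    H-R : ∀ {w v} (le : w ≤ v) a b c → Rᴵ w a b c → Rᴵ v (H le a) (H le b) (H le c)
    H-O : ∀ {w v} (le : w ≤ v) a → Oᴵ w a → Oᴵ v (H le a)
    H-S : ∀ {w v} (le : w ≤ v) a → Sᴵ w a → Sᴵ v (H le a)
    H-E : ∀ {w v} (le : w ≤ v) a b → Eᴵ w a b → Eᴵ v (H le a) (H le b)

module Forcing (M : KripkeSheaf) where
  open KripkeSheaf M

  Asg : W → Set
  Asg w = ℕ → D w

  _[_↦_] : ∀ {w} → Asg w → ℕ → D w → Asg w
  (ρ [ x ↦ d ]) y = if y ≡ᵇ x then d else ρ y

  transport : ∀ {w v} → w ≤ v → Asg w → Asg v
  transport le ρ y = H le (ρ y)

  _,_⊩_ : (w : W) → Asg w → Fm → Set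
  w , ρ ⊩ P p x   = Pᴵ w p (ρ x)
  w , ρ ⊩ R x y z = Rᴵ w (ρ x) (ρ y) (ρ z)
  w , ρ ⊩ O x     = Oᴵ w (ρ x)
  w , ρ ⊩ S x     = Sᴵ w (ρ x)
  w , ρ ⊩ E x y   = Eᴵ w (ρ x) (ρ y)
  w , ρ ⊩ (x ≐ y) = ρ x ≡ ρ y
  w , ρ ⊩ ⊤ᶠ      = ⊤
  w , ρ ⊩ ⊥ᶠ      = ⊥
  w , ρ ⊩ (φ ∧ᶠ ψ) = (w , ρ ⊩ φ) × (w , ρ ⊩ ψ)
  w , ρ ⊩ (φ ∨ᶠ ψ) = (w , ρ ⊩ φ) ⊎ (w , ρ ⊩ ψ)
  w , ρ ⊩ (φ ⇒ ψ) = ∀ v (le : w ≤ v) →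
                     v , transport le ρ ⊩ φ → v , transport le ρ ⊩ ψ
  w , ρ ⊩ ∀ᶠ x φ  = ∀ v (le : w ≤ v) (d : D v) → v , (transport le ρ [ x ↦ d ]) ⊩ φ
  w , ρ ⊩ ∃ᶠ x φ  = Σ (D w) λ d → w , (ρ [ x ↦ d ]) ⊩ φ

_⊨fo_ : (Fm → Set) → Fm → Set₁
Γ ⊨fo φ = (M : KripkeSheaf) → let open KripkeSheaf M; open Forcing M in
  (w : W) (ρ : Asg w) → (∀ θ → Γ θ → w , ρ ⊩ θ) → w , ρ ⊩ φ

-- The theory Th  (closed formulas; bound variable names 0..4 are arbitrary)

module ThVars where
  x y z w u : ℕ
  x = 0
  y = 1
  z = 2
  w = 3
  u = 4
open ThVars

data Th : Fm → Set where
  th-SO    : Th (∀ᶠ x (S x ∨ᶠ O x))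
  th-disj  : Th (∀ᶠ x (¬ᶠ (S x ∧ᶠ O x)))
  th-PO    : ∀ p → Th (∀ᶠ x (P p x ⇒ O x))
  th-E     : Th (∀ᶠ x (∀ᶠ y (E x y ⇒ (O x ∧ᶠ S y))))
  th-R     : Th (∀ᶠ x (∀ᶠ y (∀ᶠ z (R x y z ⇒ (O x ∧ᶠ S y ∧ᶠ O z)))))
  th-var   : ∀ p → Th (∃ᶠ x (S x ∧ᶠ ∀ᶠ y (E y x ⇔ P p y)))
  th-top   : Th (∃ᶠ x (S x ∧ᶠ ∀O y (E y x)))
  th-bot   : Th (∃ᶠ x (S x ∧ᶠ ∀ᶠ y (¬ᶠ (E y x))))
  th-and   : Th (∀ᶠ x (∀ᶠ y ((S x ∧ᶠ S y) ⇒
               ∃ᶠ z (S z ∧ᶠ ∀O w (E w z ⇔ (E w x ∧ᶠ E w y))))))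
  th-or    : Th (∀ᶠ x (∀ᶠ y ((S x ∧ᶠ S y) ⇒
               ∃ᶠ z (S z ∧ᶠ ∀O w (E w z ⇔ (E w x ∨ᶠ E w y))))))
  th-imp   : Th (∀ᶠ x (∀ᶠ y ((S x ∧ᶠ S y) ⇒
               ∃ᶠ z (S z ∧ᶠ ∀O w (E w z ⇔ (E w x ⇒ E w y))))))
  th-box   : Th (∀ᶠ x (∀ᶠ y ((S x ∧ᶠ S y) ⇒
               ∃ᶠ z (S z ∧ᶠ ∀O w (E w z ⇔ ∀ᶠ u (R w x u ⇒ E u y))))))
  th-dia   : Th (∀ᶠ x (∀ᶠ y ((S x ∧ᶠ S y) ⇒
               ∃ᶠ z (S z ∧ᶠ ∀O w (E w z ⇔ ∃ᶠ u (R w x u ∧ᶠ E u y))))))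
  th-ext   : Th (∀ᶠ x (∀ᶠ y ((S x ∧ᶠ S y ∧ᶠ ∀O z (E z x ⇔ E z y)) ⇒ (x ≐ y))))

-- For a conditional at free variable x the bound
-- variables are chosen as y = x+1, z = x+2, w = x+3 (pairwise distinct and
-- distinct from x; ST_z ψ / ST_w χ have only z / w free, so no capture).

ST : ℕ → 𝓛 → Fm
ST x (var p)   = P p x
ST x ⊤ᶜ        = ⊤ᶠ
ST x ⊥ᶜ        = ⊥ᶠ
ST x (ψ ∧ᶜ χ)  = ST x ψ ∧ᶠ ST x χ
ST x (ψ ∨ᶜ χ)  = ST x ψ ∨ᶠ ST x χ
ST x (ψ →ᶜ χ)  = ST x ψ ⇒ ST x χ
ST x (ψ □→ χ)  = ∃ᶠ (suc x) (S (suc x) ∧ᶠ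
                   ∀O (suc (suc x)) (E (suc (suc x)) (suc x) ⇔ ST (suc (suc x)) ψ) ∧ᶠ
                   ∀ᶠ (suc (suc (suc x))) (R x (suc x) (suc (suc (suc x))) ⇒ ST (suc (suc (suc x))) χ))
ST x (ψ ◇→ χ)  = ∃ᶠ (suc x) (S (suc x) ∧ᶠ
                   ∀O (suc (suc x)) (E (suc (suc x)) (suc x) ⇔ ST (suc (suc x)) ψ) ∧ᶠ
                   ∃ᶠ (suc (suc (suc x))) (R x (suc x) (suc (suc (suc x))) ∧ᶠ ST (suc (suc (suc x))) χ))

{-# OPTIONS --safe #-}
module Submission where

-- ST_x φ says of the value d of x exactly what a semantic clause ⟦ φ ⟧ d does, and
-- ⟦ ψ □→ χ ⟧ d (resp. ◇→) provides an S-element e whose E-extension on objects is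
-- ⟦ ψ ⟧ and all (resp. some) of whose R(d, e, ·)-successors satisfy χ.  The
-- extensionality axiom of Th makes an S-element unique given its extension, so any
-- later S-element y with extension ⟦ ψ ⟧ is the transported e and inherits its
-- property; persistence of ⟦ φ ⟧ along the sheaf maps brings d to y's world.

open import Defs
open import Data.Nat using (ℕ; suc; _+_; _≡ᵇ_; z<s)
open import Data.Nat.Properties using (≡ᵇ⇒≡; ≡⇒≡ᵇ; <⇒≢; m<n+m)
open import Data.Bool using (true; false)
open import Data.Product using (Σ; _×_; _,_; proj₁; proj₂)
open import Data.Product.Function.NonDependent.Propositional using (_×-⇔_)
open import Data.Product.Function.Dependent.Propositional using (Σ-⇔)
open import Data.Sum using (_⊎_; inj₁; inj₂)
open import Data.Sum.Function.Propositional using (_⊎-⇔_)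
open import Data.Unit using (⊤)
open import Data.Empty using (⊥; ⊥-elim)
open import Function using (_∘_)
open import Function.Bundles using (Equivalence; mk⇔) renaming (_⇔_ to _⟺_)
open import Function.Construct.Identity using (⇔-id; ↠-id)
open import Function.Construct.Symmetry using (⇔-sym)
open import Function.Construct.Composition using (_⇔-∘_)
open import Relation.Binary.PropositionalEquality
  using (_≡_; _≢_; refl; sym; trans; cong; subst; subst₂)

open Equivalence using (to; from)

m≢1+n+m : ∀ m n → m ≢ suc n + m
m≢1+n+m m n = <⇒≢ (m<n+m m z<s)

module Semantics (M : KripkeSheaf) where
  open KripkeSheaf M
  open Forcing M

  private variable
    u u₁ u₂ v : W

  update-same : ∀ (ρ : Asg v) x d → (ρ [ x ↦ d ]) x ≡ d
  update-same ρ x d with x ≡ᵇ x | ≡⇒≡ᵇ x x refl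
  ... | true  | _  = refl
  ... | false | ()

  update-other : ∀ (ρ : Asg v) x d {y} → y ≢ x → (ρ [ x ↦ d ]) y ≡ ρ y
  update-other ρ x d {y} y≢x with y ≡ᵇ x | ≡ᵇ⇒≡ y x
  ... | true  | y≡x = ⊥-elim (y≢x (y≡x _))
  ... | false | _   = refl

  H-∘ : (p : u ≤ u₁) (q : u₁ ≤ u₂) (r : u ≤ u₂) (d : D u) → H q (H p d) ≡ H r d
  H-∘ p q r d = trans (sym (H-trans p q d)) (H-irrel _ r d)

  H-id : (p : v ≤ v) (d : D v) → H p d ≡ d
  H-id p d = trans (H-irrel p ≤-refl d) (H-refl d)

  _≈_off_ : Asg v → Asg v → ℕ → Set
  τ ≈ ρ off z = ∀ k → k ≢ z → τ k ≡ ρ k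

  transport-update-off : (le : v ≤ u) (l : u ≤ u₁) (L : v ≤ u₁) (σ : Asg v) (z : ℕ) (c : D u) →
                         transport l (transport le σ [ z ↦ c ]) ≈ transport L σ off z
  transport-update-off le l L σ z c k k≢z =
    trans (cong (H l) (update-other (transport le σ) z c k≢z)) (H-∘ le l L (σ k))

  transport²-update-off : (le : v ≤ u) (l₁ : u ≤ u₁) (l₂ : u₁ ≤ u₂) (L : v ≤ u₂) (σ : Asg v) (z : ℕ) (c : D u) →
                          transport l₂ (transport l₁ (transport le σ [ z ↦ c ])) ≈ transport L σ off z
  transport²-update-off le l₁ l₂ L σ z c k k≢z =
    trans (H-∘ l₁ l₂ (≤-trans l₁ l₂) _) (transport-update-off le (≤-trans l₁ l₂) L σ z c k k≢z)

  HasExtension : (v : W) → D v → ((u : W) → v ≤ u → D u → Set) → Set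
  HasExtension v e Q = ∀ u (le : v ≤ u) c → Oᴵ u c → Eᴵ u c (H le e) ⟺ Q u le c

  AllSucc : (v : W) → D v → D v → ((u : W) → D u → Set) → Set
  AllSucc v d e Q = ∀ u (le : v ≤ u) c → Rᴵ u (H le d) (H le e) c → Q u c

  SomeSucc : (v : W) → D v → D v → ((u : W) → D u → Set) → Set
  SomeSucc v d e Q = Σ (D v) λ c → Rᴵ v d e c × Q v c

  ⟦_⟧ : 𝓛 → (v : W) → D v → Set
  ⟦ var p ⟧ v d   = Pᴵ v p d
  ⟦ ⊤ᶜ ⟧ _ _      = ⊤
  ⟦ ⊥ᶜ ⟧ _ _      = ⊥
  ⟦ ψ ∧ᶜ χ ⟧ v d  = ⟦ ψ ⟧ v d × ⟦ χ ⟧ v d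
  ⟦ ψ ∨ᶜ χ ⟧ v d  = ⟦ ψ ⟧ v d ⊎ ⟦ χ ⟧ v d
  ⟦ ψ →ᶜ χ ⟧ v d  = ∀ u (le : v ≤ u) → ⟦ ψ ⟧ u (H le d) → ⟦ χ ⟧ u (H le d)
  ⟦ ψ □→ χ ⟧ v d  = Σ (D v) λ e → Sᴵ v e × HasExtension v e (λ u _ → ⟦ ψ ⟧ u) × AllSucc v d e ⟦ χ ⟧
  ⟦ ψ ◇→ χ ⟧ v d  = Σ (D v) λ e → Sᴵ v e × HasExtension v e (λ u _ → ⟦ ψ ⟧ u) × SomeSucc v d e ⟦ χ ⟧

  HasExtension-mono : ∀ {e Q} (le : v ≤ u) → HasExtension v e Q →
                      HasExtension u (H le e) (λ u₁ l → Q u₁ (≤-trans le l))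
  HasExtension-mono {e = e} {Q} le ext u₁ l c Oc =
    subst (λ a → Eᴵ u₁ c a ⟺ Q u₁ (≤-trans le l) c) (sym (H-∘ le l _ e)) (ext u₁ (≤-trans le l) c Oc)

  AllSucc-mono : ∀ {d e Q} (le : v ≤ u) → AllSucc v d e Q → AllSucc u (H le d) (H le e) Q
  AllSucc-mono {d = d} {e} {Q} le all u₁ l c =
    subst₂ (λ a b → Rᴵ u₁ a b c → Q u₁ c) (sym (H-∘ le l _ d)) (sym (H-∘ le l _ e)) (all u₁ (≤-trans le l) c)

  ⟦⟧-mono : ∀ φ (le : v ≤ u) {d} → ⟦ φ ⟧ v d → ⟦ φ ⟧ u (H le d)
  ⟦⟧-mono (var p) le = H-P le p _
  ⟦⟧-mono ⊤ᶜ le _ = _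
  ⟦⟧-mono (ψ ∧ᶜ χ) le (a , b) = ⟦⟧-mono ψ le a , ⟦⟧-mono χ le b
  ⟦⟧-mono (ψ ∨ᶜ χ) le (inj₁ a) = inj₁ (⟦⟧-mono ψ le a)
  ⟦⟧-mono (ψ ∨ᶜ χ) le (inj₂ b) = inj₂ (⟦⟧-mono χ le b)
  ⟦⟧-mono (ψ →ᶜ χ) le {d} f u₁ l =
    subst (λ a → ⟦ ψ ⟧ u₁ a → ⟦ χ ⟧ u₁ a) (sym (H-∘ le l _ d)) (f u₁ (≤-trans le l))
  ⟦⟧-mono (ψ □→ χ) le (e , Se , ext , all) =
    H le e , H-S le e Se , HasExtension-mono le ext , AllSucc-mono le all
  ⟦⟧-mono (ψ ◇→ χ) le {d} (e , Se , ext , c , r , χc) =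
    H le e , H-S le e Se , HasExtension-mono le ext , H le c , H-R le d e c r , ⟦⟧-mono χ le χc

  Defines : Fm → ℕ → ((u : W) → D u → Set) → Set
  Defines Φ x Q = ∀ {u} (τ : Asg u) → (u , τ ⊩ Φ) ⟺ Q u (τ x)

  -- Φ may mention variables other than z (E z y′ in the extensionality axiom),
  -- so its meaning is only fixed on assignments agreeing with σ away from z.
  forces-∀O-E⇔ : ∀ (σ : Asg v) z y → y ≢ z → (Φ : Fm) (Q : (u : W) → v ≤ u → D u → Set) →
                 (∀ {u} (le : v ≤ u) (τ : Asg u) → τ ≈ transport le σ off z →
                    (u , τ ⊩ Φ) ⟺ Q u le (τ z)) →
                 (v , σ ⊩ ∀O z (E z y ⇔ Φ)) ⟺ HasExtension v (σ y) Q
  forces-∀O-E⇔ {v} σ z y y≢z Φ Q Φ⟺Q = mk⇔ forward backward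
    where
    forward : v , σ ⊩ ∀O z (E z y ⇔ Φ) → HasExtension v (σ y) Q
    forward h u le c Oc =
      subst₂ (λ a b → Eᴵ u a b ⟺ Q u le a) τz≡c (agree y y≢z)
        (mk⇔ (to (Φ⟺Q le τ agree) ∘ proj₁ forced u ≤-refl) (proj₂ forced u ≤-refl ∘ from (Φ⟺Q le τ agree)))
      where
      ρ = transport le σ [ z ↦ c ]
      τ = transport ≤-refl (transport ≤-refl ρ)
      agree = transport²-update-off le ≤-refl ≤-refl le σ z c
      ρz≡c : H ≤-refl (ρ z) ≡ c
      ρz≡c = trans (H-id _ _) (update-same (transport le σ) z c)
      τz≡c : τ z ≡ c
      τz≡c = trans (H-id _ _) ρz≡c
      forced = h u le c u ≤-refl (subst (Oᴵ u) (sym ρz≡c) Oc)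
    backward : HasExtension v (σ y) Q → v , σ ⊩ ∀O z (E z y ⇔ Φ)
    backward ext u le c u₁ l₁ Oc = (λ u₂ l₂ → to (E⟺Φ l₂)) , (λ u₂ l₂ → from (E⟺Φ l₂))
      where
      E⟺Φ : ∀ {u₂} (l₂ : u₁ ≤ u₂) → let τ = transport l₂ (transport l₁ (transport le σ [ z ↦ c ])) in
             Eᴵ u₂ (τ z) (τ y) ⟺ (u₂ , τ ⊩ Φ)
      E⟺Φ {u₂} l₂ = ⇔-sym (Φ⟺Q L τ agree) ⇔-∘
                   subst (λ b → Eᴵ u₂ (τ z) b ⟺ Q u₂ L (τ z)) (sym (agree y y≢z)) (ext u₂ L (τ z) (H-O l₂ _ Oc))
        where
        τ = transport l₂ (transport l₁ (transport le σ [ z ↦ c ]))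
        L = ≤-trans le (≤-trans l₁ l₂)
        agree = transport²-update-off le l₁ l₂ L σ z c

  forces-∀R⇒ : ∀ (σ : Asg v) x y w → x ≢ w → y ≢ w → (Φ : Fm) (Q : (u : W) → D u → Set) →
               Defines Φ w Q → (v , σ ⊩ ∀ᶠ w (R x y w ⇒ Φ)) ⟺ AllSucc v (σ x) (σ y) Q
  forces-∀R⇒ {v} σ x y w x≢w y≢w Φ Q defΦ = mk⇔ forward backward
    where
    forward : v , σ ⊩ ∀ᶠ w (R x y w ⇒ Φ) → AllSucc v (σ x) (σ y) Q
    forward h u le c =
      subst (λ c′ → Rᴵ u (H le (σ x)) (H le (σ y)) c′ → Q u c′) τw≡c
        (subst₂ (λ a b → Rᴵ u a b (τ w) → Q u (τ w)) (agree x x≢w) (agree y y≢w)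
          (to (defΦ τ) ∘ h u le c u ≤-refl))
      where
      τ = transport ≤-refl (transport le σ [ w ↦ c ])
      agree = transport-update-off le ≤-refl le σ w c
      τw≡c : τ w ≡ c
      τw≡c = trans (H-id _ _) (update-same (transport le σ) w c)
    backward : AllSucc v (σ x) (σ y) Q → v , σ ⊩ ∀ᶠ w (R x y w ⇒ Φ)
    backward all u le c u₁ l₁ r =
      from (defΦ τ) (all u₁ L (τ w) (subst₂ (λ a b → Rᴵ u₁ a b (τ w)) (agree x x≢w) (agree y y≢w) r))
      where
      τ = transport l₁ (transport le σ [ w ↦ c ])
      L = ≤-trans le l₁
      agree = transport-update-off le l₁ L σ w c

  forces-∃R∧ : ∀ (σ : Asg v) x y w → x ≢ w → y ≢ w → (Φ : Fm) (Q : (u : W) → D u → Set) →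
               Defines Φ w Q → (v , σ ⊩ ∃ᶠ w (R x y w ∧ᶠ Φ)) ⟺ SomeSucc v (σ x) (σ y) Q
  forces-∃R∧ {v} σ x y w x≢w y≢w Φ Q defΦ = Σ-⇔ (↠-id _) (at _)
    where
    at : ∀ c → let ρ = σ [ w ↦ c ] in
         (Rᴵ v (ρ x) (ρ y) (ρ w) × (v , ρ ⊩ Φ)) ⟺ (Rᴵ v (σ x) (σ y) c × Q v c)
    at c = subst (λ c′ → forced ⟺ (Rᴵ v (σ x) (σ y) c′ × Q v c′)) (update-same σ w c)
             (subst₂ (λ a b → forced ⟺ (Rᴵ v a b (ρ w) × Q v (ρ w)))
               (update-other σ w c x≢w) (update-other σ w c y≢w) (⇔-id _ ×-⇔ defΦ ρ))
      where
      ρ = σ [ w ↦ c ]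
      forced = Rᴵ v (ρ x) (ρ y) (ρ w) × (v , ρ ⊩ Φ)

  forces-conditional : ∀ (σ : Asg v) a (Φ Γ : Fm) (Q : (u : W) → D u → Set) (K : D v → D v → Set) →
    Defines Φ (2 + a) Q → (∀ (τ : Asg v) → (v , τ ⊩ Γ) ⟺ K (τ a) (τ (suc a))) →
    (v , σ ⊩ ∃ᶠ (suc a) (S (suc a) ∧ᶠ ∀O (2 + a) (E (2 + a) (suc a) ⇔ Φ) ∧ᶠ Γ))
      ⟺ (Σ (D v) λ e → Sᴵ v e × HasExtension v e (λ u _ → Q u) × K (σ a) e)
  forces-conditional {v} σ a Φ Γ Q K defΦ defΓ = Σ-⇔ (↠-id _) (at _)
    where
    at : ∀ e → let ρ = σ [ suc a ↦ e ] in
         (v , ρ ⊩ (S (suc a) ∧ᶠ ∀O (2 + a) (E (2 + a) (suc a) ⇔ Φ) ∧ᶠ Γ))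
           ⟺ (Sᴵ v e × HasExtension v e (λ u _ → Q u) × K (σ a) e)
    at e = subst₂ (λ d e′ → forced ⟺ (Sᴵ v e′ × HasExtension v e′ (λ u _ → Q u) × K d e′))
             (update-other σ (suc a) e (m≢1+n+m a 0)) (update-same σ (suc a) e)
             (⇔-id _ ×-⇔ extension ×-⇔ defΓ ρ)
      where
      ρ = σ [ suc a ↦ e ]
      forced = v , ρ ⊩ (S (suc a) ∧ᶠ ∀O (2 + a) (E (2 + a) (suc a) ⇔ Φ) ∧ᶠ Γ)
      extension = forces-∀O-E⇔ ρ (2 + a) (suc a) (m≢1+n+m (suc a) 0) Φ (λ u _ → Q u) (λ _ τ _ → defΦ τ)

  ST-correct : ∀ φ x → Defines (ST x φ) x ⟦ φ ⟧
  ST-correct (var p) x τ  = ⇔-id _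
  ST-correct ⊤ᶜ x τ       = ⇔-id _
  ST-correct ⊥ᶜ x τ       = ⇔-id _
  ST-correct (ψ ∧ᶜ χ) x τ = ST-correct ψ x τ ×-⇔ ST-correct χ x τ
  ST-correct (ψ ∨ᶜ χ) x τ = ST-correct ψ x τ ⊎-⇔ ST-correct χ x τ
  ST-correct (ψ →ᶜ χ) x τ = mk⇔
    (λ h u le → to (ST-correct χ x (transport le τ)) ∘ h u le ∘ from (ST-correct ψ x (transport le τ)))
    (λ h u le → from (ST-correct χ x (transport le τ)) ∘ h u le ∘ to (ST-correct ψ x (transport le τ)))
  ST-correct (ψ □→ χ) x τ =
    forces-conditional τ x (ST (2 + x) ψ) (∀ᶠ (3 + x) (R x (suc x) (3 + x) ⇒ ST (3 + x) χ)) ⟦ ψ ⟧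
      (λ d e → AllSucc _ d e ⟦ χ ⟧) (ST-correct ψ (2 + x))
      (λ ρ → forces-∀R⇒ ρ x (suc x) (3 + x) (m≢1+n+m x 2) (m≢1+n+m (suc x) 1) (ST (3 + x) χ) ⟦ χ ⟧
               (ST-correct χ (3 + x)))
  ST-correct (ψ ◇→ χ) x τ =
    forces-conditional τ x (ST (2 + x) ψ) (∃ᶠ (3 + x) (R x (suc x) (3 + x) ∧ᶠ ST (3 + x) χ)) ⟦ ψ ⟧
      (λ d e → SomeSucc _ d e ⟦ χ ⟧) (ST-correct ψ (2 + x))
      (λ ρ → forces-∃R∧ ρ x (suc x) (3 + x) (m≢1+n+m x 2) (m≢1+n+m (suc x) 1) (ST (3 + x) χ) ⟦ χ ⟧
               (ST-correct χ (3 + x)))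

  module ThModel {w₀ : W} (ρ₀ : Asg w₀) (th : ∀ θ → Th θ → w₀ , ρ₀ ⊩ θ) where

    Th-extensional : ∀ {d e : D v} → w₀ ≤ v → Sᴵ v d → Sᴵ v e →
                     HasExtension v d (λ u le c → Eᴵ u c (H le e)) → d ≡ e
    Th-extensional {v} {d} {e} lv = subst₂ Conclusion τ0≡d τ1≡e ext-axiom
      where
      Conclusion : D v → D v → Set
      Conclusion a b = Sᴵ v a → Sᴵ v b → HasExtension v a (λ u le c → Eᴵ u c (H le b)) → a ≡ b
      -- 0, 1 and 2 are the bound variables of th-ext.
      τ = transport ≤-refl (transport ≤-refl (transport lv ρ₀ [ 0 ↦ d ]) [ 1 ↦ e ])
      τ0≡d : τ 0 ≡ d
      τ0≡d = trans (H-id _ _) (H-id _ _)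
      τ1≡e : τ 1 ≡ e
      τ1≡e = H-id _ _
      ext-axiom : Conclusion (τ 0) (τ 1)
      ext-axiom Sd Se ext = th _ th-ext _ lv d _ ≤-refl e _ ≤-refl (Sd , Se , from same-extension ext)
        where
        same-extension = forces-∀O-E⇔ τ 2 0 (λ ()) (E 2 1) (λ u le c → Eᴵ u c (H le (τ 1)))
          (λ le τ′ agree → subst (λ b → Eᴵ _ (τ′ 2) (τ′ 1) ⟺ Eᴵ _ (τ′ 2) b) (agree 1 (λ ())) (⇔-id _))

    S-extensional : ∀ {d e : D v} {Q} → w₀ ≤ v → Sᴵ v d → Sᴵ v e →
                    HasExtension v d Q → HasExtension v e Q → d ≡ e
    S-extensional lv Sd Se ext-d ext-e =
      Th-extensional lv Sd Se (λ u le c Oc → ⇔-sym (ext-e u le c Oc) ⇔-∘ ext-d u le c Oc)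

    □→-elim : ∀ ψ χ {d e : D v} → w₀ ≤ v → ⟦ ψ □→ χ ⟧ v d → Sᴵ v e →
              HasExtension v e (λ u _ → ⟦ ψ ⟧ u) → AllSucc v d e ⟦ χ ⟧
    □→-elim ψ χ {d = d} lv (e₀ , Se₀ , ext₀ , all) Se ext =
      subst (λ e′ → AllSucc _ d e′ ⟦ χ ⟧) (S-extensional lv Se₀ Se ext₀ ext) all

    ◇→-elim : ∀ ψ χ {d e : D v} → w₀ ≤ v → ⟦ ψ ◇→ χ ⟧ v d → Sᴵ v e →
              HasExtension v e (λ u _ → ⟦ ψ ⟧ u) → SomeSucc v d e ⟦ χ ⟧
    ◇→-elim ψ χ {d = d} lv (e₀ , Se₀ , ext₀ , some) Se ext =
      subst (λ e′ → SomeSucc _ d e′ ⟦ χ ⟧) (S-extensional lv Se₀ Se ext₀ ext) some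

    elimination-forced : ∀ (φ ψ : 𝓛) (Ψ : Fm) x y z → x ≢ y → y ≢ z →
      (∀ {v} → w₀ ≤ v → (σ : Asg v) → ⟦ φ ⟧ v (σ x) → Sᴵ v (σ y) →
         HasExtension v (σ y) (λ u _ → ⟦ ψ ⟧ u) → v , σ ⊩ Ψ) →
      w₀ , ρ₀ ⊩ ∀ᶠ x (ST x φ ⇒ ∀ᶠ y ((S y ∧ᶠ ∀O z (E z y ⇔ ST z ψ)) ⇒ Ψ))
    elimination-forced φ ψ Ψ x y z x≢y y≢z semantic-rule
                       v₁ l₁ a v₂ l₂ φ-forced v₃ l₃ b v₄ l₄ (Sb , extension-forced) =
      semantic-rule (≤-trans l₁ (≤-trans l₂ L)) σ₄ φ-at-x Sb (to extension extension-forced)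
      where
      σ₂ = transport l₂ (transport l₁ ρ₀ [ x ↦ a ])
      σ₄ = transport l₄ (transport l₃ σ₂ [ y ↦ b ])
      L = ≤-trans l₃ l₄
      φ-at-x : ⟦ φ ⟧ v₄ (σ₄ x)
      φ-at-x = subst (⟦ φ ⟧ v₄) (sym (transport-update-off l₃ l₄ L σ₂ y b x x≢y))
                 (⟦⟧-mono φ L (to (ST-correct φ x σ₂) φ-forced))
      extension = forces-∀O-E⇔ σ₄ z y y≢z (ST z ψ) (λ u _ → ⟦ ψ ⟧ u) (λ _ τ _ → ST-correct ψ z τ)

□→-elimination-valid : ∀ ψ χ x y z w → x ≢ y → y ≢ z → x ≢ w → y ≢ w →
  Th ⊨fo ∀ᶠ x (ST x (ψ □→ χ) ⇒ ∀ᶠ y ((S y ∧ᶠ ∀O z (E z y ⇔ ST z ψ)) ⇒ ∀ᶠ w (R x y w ⇒ ST w χ)))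
□→-elimination-valid ψ χ x y z w x≢y y≢z x≢w y≢w M w₀ ρ₀ th =
  elimination-forced (ψ □→ χ) ψ (∀ᶠ w (R x y w ⇒ ST w χ)) x y z x≢y y≢z λ lv σ φx Sy ext →
    from (forces-∀R⇒ σ x y w x≢w y≢w (ST w χ) ⟦ χ ⟧ (ST-correct χ w)) (□→-elim ψ χ lv φx Sy ext)
  where
  open Semantics M
  open ThModel ρ₀ th

◇→-elimination-valid : ∀ ψ χ x y z w → x ≢ y → y ≢ z → x ≢ w → y ≢ w →
  Th ⊨fo ∀ᶠ x (ST x (ψ ◇→ χ) ⇒ ∀ᶠ y ((S y ∧ᶠ ∀O z (E z y ⇔ ST z ψ)) ⇒ ∃ᶠ w (R x y w ∧ᶠ ST w χ)))
◇→-elimination-valid ψ χ x y z w x≢y y≢z x≢w y≢w M w₀ ρ₀ th =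
  elimination-forced (ψ ◇→ χ) ψ (∃ᶠ w (R x y w ∧ᶠ ST w χ)) x y z x≢y y≢z λ lv σ φx Sy ext →
    from (forces-∃R∧ σ x y w x≢w y≢w (ST w χ) ⟦ χ ⟧ (ST-correct χ w)) (◇→-elim ψ χ lv φx Sy ext)
  where
  open Semantics M
  open ThModel ρ₀ th

lemma15 : (ψ χ : 𝓛) (x y z w : ℕ) →
          x ≢ y → x ≢ z → x ≢ w → y ≢ z → y ≢ w → z ≢ w →
          (Th ⊨fo ∀ᶠ x (ST x (ψ □→ χ) ⇒
             ∀ᶠ y ((S y ∧ᶠ ∀O z (E z y ⇔ ST z ψ)) ⇒ ∀ᶠ w (R x y w ⇒ ST w χ))))
          ×
          (Th ⊨fo ∀ᶠ x (ST x (ψ ◇→ χ) ⇒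
             ∀ᶠ y ((S y ∧ᶠ ∀O z (E z y ⇔ ST z ψ)) ⇒ ∃ᶠ w (R x y w ∧ᶠ ST w χ))))
lemma15 ψ χ x y z w x≢y _ x≢w y≢z y≢w _ =
    □→-elimination-valid ψ χ x y z w x≢y y≢z x≢w y≢w
  , ◇→-elimination-valid ψ χ x y z w x≢y y≢z x≢w y≢w
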